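{- Let $k\in\mathbb{N}$ and $b\in\mathbb{Q}$. Then the coefficient of $x^k$ in the power series $\dfrac{(1+2x)^b}{(1+x)^{k+1}}$ equals $4^k\binom{(b-1)/2}{k}$.
   Context: For $a\in\mathbb{Q}$ and $j\in\mathbb{N}$, $\binom{a}{j}=a(a-1)\cdots(a-j+1)/j!$, and $(1+cx)^a:=\sum_{j\ge0}\binom{a}{j}c^jx^j$. -}

module Defs where

open import Data.Nat as ℕ using (ℕ; zero; suc)
open import Data.Nat using (_!)
open import Data.Nat.Properties using (_!≢0)
open import Data.Integer as ℤ using (+_)
open import Data.Rational using (ℚ; _+_; _*_; _-_; -_; _/_; 0ℚ; 1ℚ)
open import Data.List using (List; upTo; map; foldr)

ℕtoℚ : ℕ → ℚ
ℕtoℚ n = (+ n) / 1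

falling : ℚ → ℕ → ℚ
falling a zero    = 1ℚ
falling a (suc j) = falling a j * (a - ℕtoℚ j)

binom : ℚ → ℕ → ℚ
binom a j = falling a j * ((+ 1) / (j !)) {{j !≢0}}

Series : Set
Series = ℕ → ℚ

sumTo : ℕ → (ℕ → ℚ) → ℚ
sumTo n f = foldr _+_ 0ℚ (map f (upTo n))

_⊛_ : Series → Series → Series
(f ⊛ g) n = sumTo (suc n) (λ i → f i * g (n ℕ.∸ i))

-- (1 + c x)^a := Σ_j binom a j c^j x^j
_^ℚ_ : ℚ → ℕ → ℚ
c ^ℚ zero  = 1ℚ
c ^ℚ suc j = c * (c ^ℚ j)

binomSeries : ℚ → ℚ → Series
binomSeries c a j = binom a j * (c ^ℚ j)

-- Put β = (b - 1)/2. Both the coefficient S n and 4^n binom β n satisfy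
-- (n + 1) u (n + 1) = 4 (β - n) u n with u 0 = 1, so they agree. For S n
-- this recurrence holds summand by summand up to a telescoping term: with a
-- the coefficients of (1 + 2x)^b and c⁽ⁿ⁾ those of (1 + x)^-(n+1),
--   (n + 1) a i c⁽ⁿ⁺¹⁾ (n + 1 - i) = 4 (β - n) a i c⁽ⁿ⁾ (n - i) + G (i + 1) - G i
-- where G N = - N a N c⁽ⁿ⁾ (n + 1 - N). Writing n = i + m, the ratio
-- recurrences of binomial coefficients reduce this to a polynomial identity.
module Submission where

open import Defs
open import Data.Nat as ℕ using (ℕ; zero; suc; _∸_; _!)
import Data.Nat.Properties as ℕ
open import Data.Integer as ℤ using (+_)
import Data.Integer.Properties as ℤ
open import Data.Rational
  using (ℚ; _+_; _*_; _-_; -_; _/_; 0ℚ; 1ℚ; 1/_; NonZero; fromℚᵘ)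
open import Data.Rational.Properties
  using ( toℚᵘ-injective; toℚᵘ-fromℚᵘ; fromℚᵘ-cong; toℚᵘ-homo-+; toℚᵘ-homo-*
        ; pos⇒nonZero; normalize-pos; *-inverseˡ; *-identityˡ; *-identityʳ; *-assoc
        ; *-comm; *-zeroˡ; *-distribˡ-+; +-identityˡ; +-identityʳ; +-assoc)
open import Data.Rational.Unnormalised as ℚᵘ using (mkℚᵘ; *≡*)
import Data.Rational.Unnormalised.Properties as ℚᵘ
open import Data.Rational.Solver using (module +-*-Solver)
open +-*-Solver using (solve; _:=_; _:+_; _:*_; _:-_; :-_; con)
open import Data.List using ([]; _∷_; [_]; _++_; upTo; map; foldr)
open import Data.List.Properties using (applyUpTo-∷ʳ; map-++; foldr-++)
open import Data.Product using (_,_)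
open import Function using (id; _∘_)
open import Relation.Binary.PropositionalEquality hiding ([_])
open ≡-Reasoning

fromℚᵘ-homo-+ : ∀ p q → fromℚᵘ (p ℚᵘ.+ q) ≡ fromℚᵘ p + fromℚᵘ q
fromℚᵘ-homo-+ p q = toℚᵘ-injective (ℚᵘ.≃-trans (toℚᵘ-fromℚᵘ _) (ℚᵘ.≃-sym (ℚᵘ.≃-trans
  (toℚᵘ-homo-+ (fromℚᵘ p) (fromℚᵘ q)) (ℚᵘ.+-cong (toℚᵘ-fromℚᵘ p) (toℚᵘ-fromℚᵘ q)))))

fromℚᵘ-homo-* : ∀ p q → fromℚᵘ (p ℚᵘ.* q) ≡ fromℚᵘ p * fromℚᵘ q
fromℚᵘ-homo-* p q = toℚᵘ-injective (ℚᵘ.≃-trans (toℚᵘ-fromℚᵘ _) (ℚᵘ.≃-sym (ℚᵘ.≃-trans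
  (toℚᵘ-homo-* (fromℚᵘ p) (fromℚᵘ q)) (ℚᵘ.*-cong (toℚᵘ-fromℚᵘ p) (toℚᵘ-fromℚᵘ q)))))

ℕtoℚ-+ : ∀ m n → ℕtoℚ (m ℕ.+ n) ≡ ℕtoℚ m + ℕtoℚ n
ℕtoℚ-+ m n = trans
  (fromℚᵘ-cong {mkℚᵘ (+ (m ℕ.+ n)) 0} {mkℚᵘ (+ m) 0 ℚᵘ.+ mkℚᵘ (+ n) 0} (*≡* (begin
    + (m ℕ.+ n) ℤ.* + 1           ≡⟨ ℤ.*-identityʳ _ ⟩
    + m ℤ.+ + n                   ≡⟨ sym (cong₂ ℤ._+_ (ℤ.*-identityʳ (+ m)) (ℤ.*-identityʳ (+ n))) ⟩
    + m ℤ.* + 1 ℤ.+ + n ℤ.* + 1   ≡⟨ sym (ℤ.*-identityʳ _) ⟩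
    (+ m ℤ.* + 1 ℤ.+ + n ℤ.* + 1) ℤ.* + 1 ∎)))
  (fromℚᵘ-homo-+ (mkℚᵘ (+ m) 0) (mkℚᵘ (+ n) 0))

ℕtoℚ-suc : ∀ n → ℕtoℚ (suc n) ≡ 1ℚ + ℕtoℚ n
ℕtoℚ-suc = ℕtoℚ-+ 1

ℕtoℚ-suc-nonZero : ∀ n → NonZero (ℕtoℚ (suc n))
ℕtoℚ-suc-nonZero n = pos⇒nonZero (ℕtoℚ (suc n)) {{normalize-pos (suc n) 1}}

*-cancelˡ-≡ : ∀ r .{{_ : NonZero r}} {p q} → r * p ≡ r * q → p ≡ q
*-cancelˡ-≡ r {p} {q} rp≡rq = trans (sym (1/r*[r*x]≡x p)) (trans (cong (1/ r *_) rp≡rq) (1/r*[r*x]≡x q))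
  where
  1/r*[r*x]≡x : ∀ x → 1/ r * (r * x) ≡ x
  1/r*[r*x]≡x x = trans (sym (*-assoc (1/ r) r x)) (trans (cong (_* x) (*-inverseˡ r)) (*-identityˡ x))

ℕtoℚ-suc-*-cancelˡ : ∀ n {p q} → ℕtoℚ (suc n) * p ≡ ℕtoℚ (suc n) * q → p ≡ q
ℕtoℚ-suc-*-cancelˡ n = *-cancelˡ-≡ (ℕtoℚ (suc n)) {{ℕtoℚ-suc-nonZero n}}

ℕtoℚ-suc-*-1/[suc-*] : ∀ n d .{{_ : ℕ.NonZero d}} →
  ℕtoℚ (suc n) * ((+ 1) / (suc n ℕ.* d)) {{ℕ.m*n≢0 (suc n) d}} ≡ (+ 1) / d
ℕtoℚ-suc-*-1/[suc-*] n (suc e) = trans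
  (sym (fromℚᵘ-homo-* (mkℚᵘ (+ suc n) 0) (mkℚᵘ (+ 1) (e ℕ.+ n ℕ.* suc e))))
  (fromℚᵘ-cong {mkℚᵘ (+ suc n) 0 ℚᵘ.* mkℚᵘ (+ 1) (e ℕ.+ n ℕ.* suc e)} {mkℚᵘ (+ 1) e}
    (*≡* (cong +_ (trans (cong (ℕ._* suc e) (ℕ.*-identityʳ (suc n)))
                        (sym (trans (ℕ.*-identityˡ _) (ℕ.*-identityˡ _)))))))

suc-*-binom-suc : ∀ a j → ℕtoℚ (suc j) * binom a (suc j) ≡ (a - ℕtoℚ j) * binom a j
suc-*-binom-suc a j = begin
  k * (F * (a - x) * 1/[suc-j]!)   ≡⟨ solve 4 (λ k F y r → k :* (F :* y :* r) := y :* (F :* (k :* r))) refl k F (a - x) 1/[suc-j]! ⟩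
  (a - x) * (F * (k * 1/[suc-j]!)) ≡⟨ cong (λ r → (a - x) * (F * r)) (ℕtoℚ-suc-*-1/[suc-*] j (j !) {{j ℕ.!≢0}}) ⟩
  (a - x) * binom a j              ∎
  where
  k = ℕtoℚ (suc j)
  x = ℕtoℚ j
  F = falling a j
  1/[suc-j]! = ((+ 1) / (suc j !)) {{suc j ℕ.!≢0}}

falling-suc-pred : ∀ a m → falling a (suc m) ≡ a * falling (a - 1ℚ) m
falling-suc-pred a zero    = solve 1 (λ a → con 1ℚ :* (a :- con 0ℚ) := a :* con 1ℚ) refl a
falling-suc-pred a (suc m) = begin
  falling a (suc m) * (a - ℕtoℚ (suc m)) ≡⟨ cong₂ (λ u v → u * (a - v)) (falling-suc-pred a m) (ℕtoℚ-suc m) ⟩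
  a * F * (a - (1ℚ + x))                  ≡⟨ solve 3 (λ a F x → a :* F :* (a :- (con 1ℚ :+ x)) := a :* (F :* ((a :- con 1ℚ) :- x))) refl a F x ⟩
  a * (F * ((a - 1ℚ) - x))                ∎
  where
  F = falling (a - 1ℚ) m
  x = ℕtoℚ m

*-binom-pred : ∀ a m → a * binom (a - 1ℚ) m ≡ (a - ℕtoℚ m) * binom a m
*-binom-pred a m = begin
  a * (falling (a - 1ℚ) m * r)   ≡⟨ sym (*-assoc a _ r) ⟩
  a * falling (a - 1ℚ) m * r     ≡⟨ cong (_* r) (sym (falling-suc-pred a m)) ⟩
  falling a m * (a - ℕtoℚ m) * r ≡⟨ solve 3 (λ F y r → F :* y :* r := y :* (F :* r)) refl (falling a m) (a - ℕtoℚ m) r ⟩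
  (a - ℕtoℚ m) * binom a m       ∎
  where
  r = ((+ 1) / (m !)) {{m ℕ.!≢0}}

suc-*-binom-pred-suc : ∀ a m →
  ℕtoℚ (suc m) * (a * binom (a - 1ℚ) (suc m)) ≡ (a - 1ℚ - ℕtoℚ m) * ((a - ℕtoℚ m) * binom a m)
suc-*-binom-pred-suc a m = begin
  k * (a * binom (a - 1ℚ) (suc m))      ≡⟨ solve 3 (λ k a B → k :* (a :* B) := a :* (k :* B)) refl k a _ ⟩
  a * (k * binom (a - 1ℚ) (suc m))      ≡⟨ cong (a *_) (suc-*-binom-suc (a - 1ℚ) m) ⟩
  a * ((a - 1ℚ - x) * binom (a - 1ℚ) m) ≡⟨ solve 3 (λ a y B → a :* (y :* B) := y :* (a :* B)) refl a (a - 1ℚ - x) _ ⟩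
  (a - 1ℚ - x) * (a * binom (a - 1ℚ) m) ≡⟨ cong ((a - 1ℚ - x) *_) (*-binom-pred a m) ⟩
  (a - 1ℚ - x) * ((a - x) * binom a m)  ∎
  where
  k = ℕtoℚ (suc m)
  x = ℕtoℚ m

suc-*-binomSeries-suc : ∀ c a j →
  ℕtoℚ (suc j) * binomSeries c a (suc j) ≡ c * (a - ℕtoℚ j) * binomSeries c a j
suc-*-binomSeries-suc c a j = begin
  k * (binom a (suc j) * (c * cʲ))  ≡⟨ solve 4 (λ k B c p → k :* (B :* (c :* p)) := c :* p :* (k :* B)) refl k _ c cʲ ⟩
  c * cʲ * (k * binom a (suc j))    ≡⟨ cong (c * cʲ *_) (suc-*-binom-suc a j) ⟩
  c * cʲ * ((a - x) * binom a j)    ≡⟨ solve 4 (λ c p y B → c :* p :* (y :* B) := c :* y :* (B :* p)) refl c cʲ (a - x) _ ⟩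
  c * (a - x) * binomSeries c a j   ∎
  where
  k = ℕtoℚ (suc j)
  x = ℕtoℚ j
  cʲ = c ^ℚ j

1^ℚ : ∀ j → 1ℚ ^ℚ j ≡ 1ℚ
1^ℚ zero    = refl
1^ℚ (suc j) = trans (*-identityˡ _) (1^ℚ j)

binomSeries-1 : ∀ a j → binomSeries 1ℚ a j ≡ binom a j
binomSeries-1 a j = trans (cong (binom a j *_) (1^ℚ j)) (*-identityʳ _)

foldr-+-init : ∀ z xs → foldr _+_ z xs ≡ foldr _+_ 0ℚ xs + z
foldr-+-init z []       = sym (+-identityˡ z)
foldr-+-init z (x ∷ xs) = trans (cong (_+_ x) (foldr-+-init z xs)) (sym (+-assoc x _ z))

sumTo-suc : ∀ n f → sumTo (suc n) f ≡ sumTo n f + f n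
sumTo-suc n f = begin
  foldr _+_ 0ℚ (map f (upTo (suc n)))           ≡⟨ cong (foldr _+_ 0ℚ ∘ map f) (sym (applyUpTo-∷ʳ id n)) ⟩
  foldr _+_ 0ℚ (map f (upTo n ++ [ n ]))        ≡⟨ cong (foldr _+_ 0ℚ) (map-++ f (upTo n) [ n ]) ⟩
  foldr _+_ 0ℚ (map f (upTo n) ++ [ f n ])      ≡⟨ foldr-++ _+_ 0ℚ (map f (upTo n)) [ f n ] ⟩
  foldr _+_ (f n + 0ℚ) (map f (upTo n))         ≡⟨ foldr-+-init (f n + 0ℚ) (map f (upTo n)) ⟩
  sumTo n f + (f n + 0ℚ)                        ≡⟨ cong (_+_ (sumTo n f)) (+-identityʳ (f n)) ⟩
  sumTo n f + f n                               ∎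

sumTo-telescoping : ∀ r s (f g G : ℕ → ℚ) n →
  (∀ i → i ℕ.< n → r * f i ≡ s * g i + (G (suc i) - G i)) →
  r * sumTo n f ≡ s * sumTo n g + (G n - G 0)
sumTo-telescoping r s f g G zero _ =
  solve 3 (λ r s G₀ → r :* con 0ℚ := s :* con 0ℚ :+ (G₀ :- G₀)) refl r s (G 0)
sumTo-telescoping r s f g G (suc n) step = begin
  r * sumTo (suc n) f                                                ≡⟨ cong (r *_) (sumTo-suc n f) ⟩
  r * (sumTo n f + f n)                                              ≡⟨ *-distribˡ-+ r _ _ ⟩
  r * sumTo n f + r * f n                                            ≡⟨ cong₂ _+_ (sumTo-telescoping r s f g G n (λ i i<n → step i (ℕ.m<n⇒m<1+n i<n))) (step n ℕ.≤-refl) ⟩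
  (s * sumTo n g + (G n - G 0)) + (s * g n + (G (suc n) - G n))     ≡⟨ solve 6 (λ s Σ y G₀ Gₙ Gₙ₊₁ → (s :* Σ :+ (Gₙ :- G₀)) :+ (s :* y :+ (Gₙ₊₁ :- Gₙ)) := s :* (Σ :+ y) :+ (Gₙ₊₁ :- G₀)) refl s (sumTo n g) (g n) (G 0) (G n) (G (suc n)) ⟩
  s * (sumTo n g + g n) + (G (suc n) - G 0)                          ≡⟨ cong (λ t → s * t + (G (suc n) - G 0)) (sym (sumTo-suc n g)) ⟩
  s * sumTo (suc n) g + (G (suc n) - G 0)                            ∎

recurrence-unique : ∀ (r u v : ℕ → ℚ) → u 0 ≡ v 0 →
  (∀ n → ℕtoℚ (suc n) * u (suc n) ≡ r n * u n) →
  (∀ n → ℕtoℚ (suc n) * v (suc n) ≡ r n * v n) →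
  ∀ n → u n ≡ v n
recurrence-unique r u v u₀≡v₀ u-rec v-rec zero    = u₀≡v₀
recurrence-unique r u v u₀≡v₀ u-rec v-rec (suc n) = ℕtoℚ-suc-*-cancelˡ n (begin
  ℕtoℚ (suc n) * u (suc n) ≡⟨ u-rec n ⟩
  r n * u n                ≡⟨ cong (r n *_) (recurrence-unique r u v u₀≡v₀ u-rec v-rec n) ⟩
  r n * v n                ≡⟨ v-rec n ⟨
  ℕtoℚ (suc n) * v (suc n) ∎)

negBinomSeries : ℕ → Series
negBinomSeries n = binomSeries 1ℚ (- ℕtoℚ (suc n))

coefficient : ℚ → ℕ → ℚ
coefficient b n = (binomSeries (ℕtoℚ 2) b ⊛ negBinomSeries n) n

halfPred : ℚ → ℚ
halfPred b = (b - 1ℚ) * ((+ 1) / 2)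

ratio : ℚ → ℕ → ℚ
ratio b n = ℕtoℚ 4 * (halfPred b - ℕtoℚ n)

telescopingTerm : ℚ → ℕ → ℕ → ℚ
telescopingTerm b n N = - (ℕtoℚ N * (binomSeries (ℕtoℚ 2) b N * negBinomSeries n (suc n ∸ N)))

ratio-expand : ∀ b n → ratio b n ≡ ℕtoℚ 2 * (b - 1ℚ - ℕtoℚ 2 * ℕtoℚ n)
ratio-expand b n = begin
  ℕtoℚ 4 * ((b - 1ℚ) * ½ - x)                 ≡⟨ solve 3 (λ b h x → con (ℕtoℚ 4) :* ((b :- con 1ℚ) :* h :- x) := con (ℕtoℚ 2) :* (b :- con 1ℚ) :* (con (ℕtoℚ 2) :* h) :- con (ℕtoℚ 2) :* (con (ℕtoℚ 2) :* x)) refl b ½ x ⟩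
  two * (b - 1ℚ) * (two * ½) - two * (two * x) ≡⟨⟩
  two * (b - 1ℚ) * 1ℚ - two * (two * x)        ≡⟨ solve 2 (λ b x → con (ℕtoℚ 2) :* (b :- con 1ℚ) :* con 1ℚ :- con (ℕtoℚ 2) :* (con (ℕtoℚ 2) :* x) := con (ℕtoℚ 2) :* (b :- con 1ℚ :- con (ℕtoℚ 2) :* x)) refl b x ⟩
  two * (b - 1ℚ - two * x)                     ∎
  where
  ½ = (+ 1) / 2
  two = ℕtoℚ 2
  x = ℕtoℚ n

telescoping-polynomial-identity : ∀ x y b A D {K k M} →
  K ≡ 1ℚ + (x + y) → k ≡ 1ℚ + y → M ≡ ℕtoℚ 2 * (b - 1ℚ - ℕtoℚ 2 * (x + y)) →
  - (A * ((- K - 1ℚ - y) * ((- K - y) * D)))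
    ≡ k * M * (A * D) - ℕtoℚ 2 * (b - x) * A * (k * D) + x * A * ((- K - y) * D)
telescoping-polynomial-identity x y b A D refl refl refl = solve 5 (λ x y b A D →
  let two = con (ℕtoℚ 2)
      K = con 1ℚ :+ (x :+ y)
  in  :- (A :* ((:- K :- con 1ℚ :- y) :* ((:- K :- y) :* D)))
      := (con 1ℚ :+ y) :* (two :* (b :- con 1ℚ :- two :* (x :+ y))) :* (A :* D)
         :- two :* (b :- x) :* A :* ((con 1ℚ :+ y) :* D) :+ x :* A :* ((:- K :- y) :* D))
  refl x y b A D

cauchyTerm-telescopes : ∀ b {i n} → i ℕ.≤ n →
  ℕtoℚ (suc n) * (binomSeries (ℕtoℚ 2) b i * negBinomSeries (suc n) (suc n ∸ i))
    ≡ ratio b n * (binomSeries (ℕtoℚ 2) b i * negBinomSeries n (n ∸ i))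
      + (telescopingTerm b n (suc i) - telescopingTerm b n i)
cauchyTerm-telescopes b {i} i≤n with ℕ.m≤n⇒∃[o]m+o≡n i≤n
... | m , refl rewrite ℕ.+-∸-assoc 1 (ℕ.m≤m+n i m) | ℕ.m+n∸m≡n i m = ℕtoℚ-suc-*-cancelˡ m (begin
  k * (K * (A * C′))                                          ≡⟨ solve 4 (λ k K A C′ → k :* (K :* (A :* C′)) := :- (A :* (k :* (:- K :* C′)))) refl k K A C′ ⟩
  - (A * (k * (- K * C′)))                                    ≡⟨ cong (λ t → - (A * t)) C-step ⟩
  - (A * ((- K - 1ℚ - y) * ((- K - y) * D)))                  ≡⟨ telescoping-polynomial-identity x y b A D K≡ (ℕtoℚ-suc m) M≡ ⟩
  k * M * (A * D) - ℕtoℚ 2 * (b - x) * A * (k * D)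
    + x * A * ((- K - y) * D)                                 ≡⟨ cong₂ (λ u v → k * M * (A * D) - u * (k * D) + x * A * v) (sym a-step) (sym D-step) ⟩
  k * M * (A * D) - ℕtoℚ (suc i) * A′ * (k * D) + x * A * (k * D′)
                                                              ≡⟨ solve 8 (λ k M A D i′ A′ x D′ → k :* M :* (A :* D) :- i′ :* A′ :* (k :* D) :+ x :* A :* (k :* D′) := k :* (M :* (A :* D) :+ (:- (i′ :* (A′ :* D)) :- :- (x :* (A :* D′))))) refl k M A D (ℕtoℚ (suc i)) A′ x D′ ⟩
  k * (M * (A * D) + (- (ℕtoℚ (suc i) * (A′ * D)) - - (x * (A * D′)))) ∎)
  where
  n = i ℕ.+ m
  x = ℕtoℚ i
  y = ℕtoℚ m
  K = ℕtoℚ (suc n)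
  k = ℕtoℚ (suc m)
  M = ratio b n
  A = binomSeries (ℕtoℚ 2) b i
  A′ = binomSeries (ℕtoℚ 2) b (suc i)
  D = negBinomSeries n m
  D′ = negBinomSeries n (suc m)
  C′ = negBinomSeries (suc n) (suc m)
  K≡ : K ≡ 1ℚ + (x + y)
  K≡ = trans (ℕtoℚ-suc n) (cong (_+_ 1ℚ) (ℕtoℚ-+ i m))
  M≡ : M ≡ ℕtoℚ 2 * (b - 1ℚ - ℕtoℚ 2 * (x + y))
  M≡ = trans (ratio-expand b n) (cong (λ t → ℕtoℚ 2 * (b - 1ℚ - ℕtoℚ 2 * t)) (ℕtoℚ-+ i m))
  a-step : ℕtoℚ (suc i) * A′ ≡ ℕtoℚ 2 * (b - x) * A
  a-step = suc-*-binomSeries-suc (ℕtoℚ 2) b i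
  D-step : k * D′ ≡ (- K - y) * D
  D-step = begin
    k * D′                     ≡⟨ cong (k *_) (binomSeries-1 (- K) (suc m)) ⟩
    k * binom (- K) (suc m)    ≡⟨ suc-*-binom-suc (- K) m ⟩
    (- K - y) * binom (- K) m  ≡⟨ cong ((- K - y) *_) (binomSeries-1 (- K) m) ⟨
    (- K - y) * D              ∎
  C-step : k * (- K * C′) ≡ (- K - 1ℚ - y) * ((- K - y) * D)
  C-step = begin
    k * (- K * C′)                                  ≡⟨ cong (λ t → k * (- K * t)) (binomSeries-1 _ (suc m)) ⟩
    k * (- K * binom (- ℕtoℚ (suc (suc n))) (suc m)) ≡⟨ cong (λ a → k * (- K * binom a (suc m))) -[2+n]≡-K-1 ⟩
    k * (- K * binom (- K - 1ℚ) (suc m))            ≡⟨ suc-*-binom-pred-suc (- K) m ⟩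
    (- K - 1ℚ - y) * ((- K - y) * binom (- K) m)    ≡⟨ cong (λ t → (- K - 1ℚ - y) * ((- K - y) * t)) (binomSeries-1 (- K) m) ⟨
    (- K - 1ℚ - y) * ((- K - y) * D)                ∎
    where
    -[2+n]≡-K-1 : - ℕtoℚ (suc (suc n)) ≡ - K - 1ℚ
    -[2+n]≡-K-1 = trans (cong -_ (ℕtoℚ-suc (suc n))) (solve 1 (λ K → :- (con 1ℚ :+ K) := :- K :- con 1ℚ) refl K)

coefficient-recurrence : ∀ b n → ℕtoℚ (suc n) * coefficient b (suc n) ≡ ratio b n * coefficient b n
coefficient-recurrence b n = begin
  K * sumTo (suc (suc n)) f                               ≡⟨ cong (K *_) (sumTo-suc (suc n) f) ⟩
  K * (sumTo (suc n) f + f (suc n))                       ≡⟨ *-distribˡ-+ K (sumTo (suc n) f) (f (suc n)) ⟩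
  K * sumTo (suc n) f + K * f (suc n)                     ≡⟨ cong (_+ K * f (suc n)) telescoped ⟩
  (M * sumTo (suc n) g + (G (suc n) - G 0)) + K * f (suc n) ≡⟨ cong₂ (λ u v → (M * sumTo (suc n) g + (u - v)) + K * f (suc n)) G-last G-zero ⟩
  (M * sumTo (suc n) g + (- (K * f (suc n)) - 0ℚ)) + K * f (suc n)
                                                          ≡⟨ solve 3 (λ M Σ t → (M :* Σ :+ (:- t :- con 0ℚ)) :+ t := M :* Σ) refl M (sumTo (suc n) g) (K * f (suc n)) ⟩
  M * sumTo (suc n) g                                     ∎
  where
  K = ℕtoℚ (suc n)
  M = ratio b n
  G = telescopingTerm b n
  f g : ℕ → ℚ
  f i = binomSeries (ℕtoℚ 2) b i * negBinomSeries (suc n) (suc n ∸ i)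
  g i = binomSeries (ℕtoℚ 2) b i * negBinomSeries n (n ∸ i)
  telescoped : K * sumTo (suc n) f ≡ M * sumTo (suc n) g + (G (suc n) - G 0)
  telescoped = sumTo-telescoping K M f g G (suc n) (λ i i<1+n → cauchyTerm-telescopes b (ℕ.≤-pred i<1+n))
  G-last : G (suc n) ≡ - (K * f (suc n))
  G-last = trans (cong (λ j → - (K * (binomSeries (ℕtoℚ 2) b (suc n) * negBinomSeries n j))) (ℕ.n∸n≡0 n))
                 (cong (λ j → - (K * (binomSeries (ℕtoℚ 2) b (suc n) * negBinomSeries (suc n) j))) (sym (ℕ.n∸n≡0 n)))
  G-zero : G 0 ≡ 0ℚ
  G-zero = cong -_ (*-zeroˡ (binomSeries (ℕtoℚ 2) b 0 * negBinomSeries n (suc n)))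

closedForm-recurrence : ∀ b n →
  ℕtoℚ (suc n) * ((ℕtoℚ 4 ^ℚ suc n) * binom (halfPred b) (suc n))
    ≡ ratio b n * ((ℕtoℚ 4 ^ℚ n) * binom (halfPred b) n)
closedForm-recurrence b n = begin
  ℕtoℚ (suc n) * ((ℕtoℚ 4 ^ℚ suc n) * binom β (suc n)) ≡⟨ cong (ℕtoℚ (suc n) *_) (*-comm (ℕtoℚ 4 ^ℚ suc n) (binom β (suc n))) ⟩
  ℕtoℚ (suc n) * binomSeries (ℕtoℚ 4) β (suc n)        ≡⟨ suc-*-binomSeries-suc (ℕtoℚ 4) β n ⟩
  ratio b n * binomSeries (ℕtoℚ 4) β n                 ≡⟨ cong (ratio b n *_) (*-comm (binom β n) (ℕtoℚ 4 ^ℚ n)) ⟩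
  ratio b n * ((ℕtoℚ 4 ^ℚ n) * binom β n)              ∎
  where
  β = halfPred b

lemma2 : (k : ℕ) (b : ℚ) →
    (binomSeries (ℕtoℚ 2) b ⊛ binomSeries 1ℚ (- ℕtoℚ (suc k))) k
      ≡ (ℕtoℚ 4 ^ℚ k) * binom ((b - 1ℚ) * ((+ 1) / 2)) k
lemma2 k b = recurrence-unique (ratio b) (coefficient b) (λ n → (ℕtoℚ 4 ^ℚ n) * binom (halfPred b) n)
  refl (coefficient-recurrence b) (closedForm-recurrence b) k
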